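{- Let $G$ be a connected graph. Then $\mathrm{srd}(G)=e(G)$ if and only if $G=P_2$, where $e(G)$ is the number of edges of $G$ and $P_2$ is the path on two vertices.
   Context: All graphs are simple, finite and undirected. An edge-coloring of $G$ is any map $c:E(G)\to[k]$ (adjacent edges may receive the same color). For distinct vertices $u,v$ of a connected graph $G$, a $u$-$v$-edge-cut is a set $F$ of edges such that $u$ and $v$ lie in different components of $G-F$; a minimum $u$-$v$-edge-cut is one of minimum size among these. A set of edges is rainbow if no two of its edges have the same color. An edge-colored connected graph is strong rainbow disconnected if for every two distinct vertices $u,v$ there is a $u$-$v$-edge-cut that is both rainbow and minimum. $\mathrm{srd}(G)$ is the smallest number of colors of an edge-coloring making $G$ strong rainbow disconnected. -}

module Defs where

open import Data.Nat using (ℕ; zero; suc; _+_; _≤_; _<_; _<ᵇ_)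
open import Data.Bool using (Bool; true; false; _∧_; _∨_; not; if_then_else_)
open import Data.Fin using (Fin; toℕ)
open import Data.List using (List; map; allFin)
open import Data.Nat.ListAction using (sum)
open import Data.Product using (Σ; _×_; _,_; ∃)
open import Data.Sum using (_⊎_)
open import Relation.Binary.PropositionalEquality using (_≡_)
open import Relation.Nullary using (¬_)
open import Function.Bundles using (_↔_; Inverse)

record Graph (n : ℕ) : Set where
  field
    adj    : Fin n → Fin n → Bool
    sym    : ∀ u v → adj u v ≡ adj v u
    irrefl : ∀ u → adj u u ≡ false
open Graph public

-- A set of (potential) edges, given by a Bool predicate on vertex pairs.
-- The unordered pair {u,v} belongs to F iff F u v or F v u.
EdgeSet : ℕ → Set
EdgeSet n = Fin n → Fin n → Bool

inF : ∀ {n} → EdgeSet n → Fin n → Fin n → Bool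
inF F u v = F u v ∨ F v u

∅E : ∀ {n} → EdgeSet n
∅E _ _ = false

data Reach {n : ℕ} (G : Graph n) (F : EdgeSet n) (u : Fin n) : Fin n → Set where
  here : Reach G F u u
  step : ∀ {w x} → Reach G F u w → adj G w x ≡ true → inF F w x ≡ false
       → Reach G F u x

Connected : ∀ {n} → Graph n → Set
Connected G = ∀ u v → Reach G ∅E u v

count : ∀ {n} → Graph n → EdgeSet n → ℕ
count {n} G F =
  sum (map (λ i → sum (map (λ j →
    if (toℕ i <ᵇ toℕ j) ∧ adj G i j ∧ inF F i j then 1 else 0)
    (allFin n))) (allFin n))

allE : ∀ {n} → EdgeSet n
allE _ _ = true

e : ∀ {n} → Graph n → ℕ
e G = count G allE

IsCut : ∀ {n} → Graph n → Fin n → Fin n → EdgeSet n → Set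
IsCut G u v F = ¬ Reach G F u v

IsMinCut : ∀ {n} → Graph n → Fin n → Fin n → EdgeSet n → Set
IsMinCut G u v F = IsCut G u v F × (∀ F' → IsCut G u v F' → count G F ≤ count G F')

EdgeColoring : ∀ {n} → Graph n → ℕ → Set
EdgeColoring {n} G k =
  Σ ((u v : Fin n) → adj G u v ≡ true → Fin k) λ c →
    ∀ u v (p : adj G u v ≡ true) (q : adj G v u ≡ true) → c u v p ≡ c v u q

Rainbow : ∀ {n} (G : Graph n) {k} → EdgeColoring G k → EdgeSet n → Set
Rainbow {n} G (c , _) F =
  ∀ (a b a' b' : Fin n) (p : adj G a b ≡ true) (p' : adj G a' b' ≡ true) →
    inF F a b ≡ true → inF F a' b' ≡ true → c a b p ≡ c a' b' p' →
    (a ≡ a' × b ≡ b') ⊎ (a ≡ b' × b ≡ a')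

StrongRainbowDisconnected : ∀ {n} (G : Graph n) {k} → EdgeColoring G k → Set
StrongRainbowDisconnected {n} G col =
  ∀ (u v : Fin n) → ¬ (u ≡ v) →
    ∃ λ (F : EdgeSet n) → IsMinCut G u v F × Rainbow G col F

IsSrd : ∀ {n} → Graph n → ℕ → Set
IsSrd G k =
  (Σ (EdgeColoring G k) (StrongRainbowDisconnected G)) ×
  (∀ k' → Σ (EdgeColoring G k') (StrongRainbowDisconnected G) → k ≤ k')

Iso : ∀ {n m} → Graph n → Graph m → Set
Iso {n} {m} G H = Σ (Fin n ↔ Fin m) λ f →
  ∀ u v → adj G u v ≡ adj H (Inverse.to f u) (Inverse.to f v)

P₂ : Graph 2
P₂ = record { adj = a ; sym = s ; irrefl = i }
  where
  a : Fin 2 → Fin 2 → Bool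
  a Fin.zero Fin.zero = false
  a Fin.zero (Fin.suc Fin.zero) = true
  a (Fin.suc Fin.zero) Fin.zero = true
  a (Fin.suc Fin.zero) (Fin.suc Fin.zero) = false
  s : ∀ u v → a u v ≡ a v u
  s Fin.zero Fin.zero = _≡_.refl
  s Fin.zero (Fin.suc Fin.zero) = _≡_.refl
  s (Fin.suc Fin.zero) Fin.zero = _≡_.refl
  s (Fin.suc Fin.zero) (Fin.suc Fin.zero) = _≡_.refl
  i : ∀ u → a u u ≡ false
  i Fin.zero = _≡_.refl
  i (Fin.suc Fin.zero) = _≡_.refl

{-# OPTIONS --safe #-}
module Submission where

-- For G = P₂ both srd(G) and e(G) equal 1. Conversely, for a connected G on n ≥ 3 vertices
-- we build a strong rainbow disconnecting colouring with e(G) − 1 colours: all edges get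
-- distinct colours except two edges e₁ ≠ e₂, chosen so that every pair u ≠ v has a minimum
-- cut containing at most one of them. Minimum cuts can be taken of the form δ(X). Fix a
-- minimum side S_uv for every pair. If some S_pq and its complement both contain an edge,
-- let e₁ lie inside S_pq and e₂ outside: by submodularity of X ↦ |δ(X)| every minimum u-v
-- side can be uncrossed with S_pq into one that is constant on S_pq or on its complement,
-- and its cut misses e₁ or e₂. Otherwise one side of each S_uv is independent, so the star
-- at u or at v is a minimum u-v cut; then take e₁, e₂ at a vertex w of maximum degree
-- (which has two neighbours, as G is connected with n ≥ 3) and, when the star at w is the
-- minimum one, use the star at the other endpoint instead.
-- In that direction the goal is ⊥, so reachability needs no decision procedure: excluded
-- middle is available under a double negation.

open import Defs renaming (sym to adj-sym; irrefl to adj-irrefl)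
open import Data.Bool using (Bool; true; false; _∧_; _∨_; not; _xor_; if_then_else_)
open import Data.Bool.Properties using (¬-not; ∧-zeroʳ; ∨-zeroʳ; ∨-identityʳ; ∨-comm; T-≡)
  renaming (_≟_ to _≟ᵇ_)
open import Data.Empty using (⊥; ⊥-elim)
open import Data.Fin using (Fin; zero; suc; toℕ; combine; remQuot; punchOut; fromℕ<)
open import Data.Fin.Permutation using (↔⇒≡)
open import Data.Fin.Properties
  using (_≟_; any?; suc-injective; toℕ-injective; toℕ-fromℕ<; remQuot-combine; punchOut-injective)
open import Data.List using (tabulate; map; allFin)
open import Data.List.Extrema.Nat using (argmax; f[xs]≤f[argmax])
open import Data.List.Membership.Propositional.Properties using (∈-allFin)
open import Data.List.Properties using (map-tabulate; tabulate-cong)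
import Data.List.Relation.Unary.All as All
open import Data.Nat using (ℕ; zero; suc; pred; _+_; _≤_; _<_; _<ᵇ_; z≤n; s≤s)
open import Data.Nat.ListAction using (sum)
open import Data.Nat.Properties
  using ( ≤-refl; ≤-reflexive; ≤-antisym; ≤-trans; <-trans; ≤-<-trans; <-cmp; <⇒≤; <⇒≢; <⇒≱; ≤⇒≯
        ; ≮⇒≥; ≤∧≢⇒<; <ᵇ⇒<; <ᵇ-reflects-<; +-comm; +-identityʳ; +-mono-≤; +-monoˡ-≤; +-mono-<-≤
        ; +-mono-≤-<; +-cancelˡ-≤; +-commutativeSemigroup; module ≤-Reasoning)
open import Algebra.Properties.CommutativeSemigroup +-commutativeSemigroup using (interchange)
open import Data.Product using (Σ; ∃; _×_; _,_; proj₁; proj₂)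
open import Data.Sum using (_⊎_; inj₁; inj₂; [_,_]′)
open import Effect.Monad using (RawMonad)
open import Function using (_∘_; id; Equivalence)
open import Function.Bundles using (_⇔_; mk⇔)
open import Function.Construct.Identity using (↔-id)
open import Relation.Binary using (tri<; tri≈; tri>)
open import Relation.Binary.PropositionalEquality
  using (_≡_; _≢_; refl; sym; trans; cong; cong₂; subst; subst₂; ≢-sym; module ≡-Reasoning)
open import Relation.Nullary using (¬_; Dec; yes; no; does; ofʸ; ofⁿ; _×-dec_; ¬¬-excluded-middle)
open import Relation.Nullary.Decidable using (dec-true; dec-false; decidable-stable)
open import Relation.Nullary.Negation using (contradiction; ¬¬-map; ¬¬-Monad)

private variable
  n : ℕ

¬¬-∀-Fin : {P : Fin n → Set} → (∀ x → ¬ ¬ P x) → ¬ ¬ (∀ x → P x)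
¬¬-∀-Fin {zero}  _   ¬∀P = ¬∀P λ ()
¬¬-∀-Fin {suc n} ¬¬P ¬∀P = ¬¬P zero λ P0 → ¬¬-∀-Fin (¬¬P ∘ suc) λ P-suc →
  ¬∀P λ { zero → P0 ; (suc x) → P-suc x }

¬¬-→ : {A B : Set} → (A → ¬ ¬ B) → ¬ ¬ (A → B)
¬¬-→ A⇒¬¬B ¬[A→B] = ¬[A→B] λ a → ⊥-elim (A⇒¬¬B a λ b → ¬[A→B] λ _ → b)

∃-argmax : (f : Fin n → ℕ) → Fin n → ∃ λ w → ∀ x → f x ≤ f w
∃-argmax f x = argmax f x (allFin _) , λ y → All.lookup (f[xs]≤f[argmax] x (allFin _)) (∈-allFin y)

∑ : (Fin n → ℕ) → ℕ
∑ f = sum (tabulate f)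

∑-zero : {f : Fin n → ℕ} → (∀ x → f x ≡ 0) → ∑ f ≡ 0
∑-zero {zero}  f≡0 = refl
∑-zero {suc n} f≡0 = cong₂ _+_ (f≡0 zero) (∑-zero (f≡0 ∘ suc))

∑-single : {f : Fin n → ℕ} (y : Fin n) → (∀ x → x ≢ y → f x ≡ 0) → ∑ f ≡ f y
∑-single {f = f} zero f≡0 =
  trans (cong (f zero +_) (∑-zero λ x → f≡0 (suc x) λ ())) (+-identityʳ (f zero))
∑-single (suc y) f≡0 =
  cong₂ _+_ (f≡0 zero λ ()) (∑-single y λ x x≢y → f≡0 (suc x) (x≢y ∘ suc-injective))

∑-mono-≤ : {f g : Fin n → ℕ} → (∀ x → f x ≤ g x) → ∑ f ≤ ∑ g
∑-mono-≤ {zero}  f≤g = z≤n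
∑-mono-≤ {suc n} f≤g = +-mono-≤ (f≤g zero) (∑-mono-≤ (f≤g ∘ suc))

∑-mono-< : {f g : Fin n → ℕ} → (∀ x → f x ≤ g x) → ∀ y → f y < g y → ∑ f < ∑ g
∑-mono-< f≤g zero    fy<gy = +-mono-<-≤ fy<gy (∑-mono-≤ (f≤g ∘ suc))
∑-mono-< f≤g (suc y) fy<gy = +-mono-≤-< (f≤g zero) (∑-mono-< (f≤g ∘ suc) y fy<gy)

∑-distrib-+ : (f g : Fin n → ℕ) → ∑ (λ x → f x + g x) ≡ ∑ f + ∑ g
∑-distrib-+ {zero}  f g = refl
∑-distrib-+ {suc n} f g =
  trans (cong (f zero + g zero +_) (∑-distrib-+ (f ∘ suc) (g ∘ suc)))
        (interchange (f zero) (g zero) (∑ (f ∘ suc)) (∑ (g ∘ suc)))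

∑₂ : (Fin n → Fin n → ℕ) → ℕ
∑₂ f = ∑ λ i → ∑ (f i)

∑₂-zero : {f : Fin n → Fin n → ℕ} → (∀ i j → f i j ≡ 0) → ∑₂ f ≡ 0
∑₂-zero f≡0 = ∑-zero λ i → ∑-zero (f≡0 i)

∑₂-single : {f : Fin n → Fin n → ℕ} (p q : Fin n) →
            (∀ i j → (i , j) ≢ (p , q) → f i j ≡ 0) → ∑₂ f ≡ f p q
∑₂-single p q f≡0 = trans
  (∑-single p λ i i≢p → ∑-zero λ j → f≡0 i j λ { refl → i≢p refl })
  (∑-single q λ j j≢q → f≡0 p j λ { refl → j≢q refl })

∑₂-mono-≤ : {f g : Fin n → Fin n → ℕ} → (∀ i j → f i j ≤ g i j) → ∑₂ f ≤ ∑₂ g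
∑₂-mono-≤ f≤g = ∑-mono-≤ λ i → ∑-mono-≤ (f≤g i)

∑₂-mono-< : {f g : Fin n → Fin n → ℕ} → (∀ i j → f i j ≤ g i j) →
            ∀ p q → f p q < g p q → ∑₂ f < ∑₂ g
∑₂-mono-< f≤g p q fpq<gpq = ∑-mono-< (λ i → ∑-mono-≤ (f≤g i)) p (∑-mono-< (f≤g p) q fpq<gpq)

∑₂-distrib-+ : (f g : Fin n → Fin n → ℕ) → ∑₂ (λ i j → f i j + g i j) ≡ ∑₂ f + ∑₂ g
∑₂-distrib-+ f g = trans (cong sum (tabulate-cong λ i → ∑-distrib-+ (f i) (g i)))
                         (∑-distrib-+ (∑ ∘ f) (∑ ∘ g))

𝟙 : Bool → ℕ
𝟙 b = if b then 1 else 0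

𝟙≤1 : ∀ b → 𝟙 b ≤ 1
𝟙≤1 false = z≤n
𝟙≤1 true  = ≤-refl

𝟙-mono : ∀ {b b'} → (b ≡ true → b' ≡ true) → 𝟙 b ≤ 𝟙 b'
𝟙-mono {false} _ = z≤n
𝟙-mono {true}  b⇒b' rewrite b⇒b' refl = ≤-refl

true-false-≢ : ∀ {a b} → a ≡ true → b ≡ false → a ≢ b
true-false-≢ refl refl ()

<⇒<ᵇ≡true : ∀ {m n} → m < n → (m <ᵇ n) ≡ true
<⇒<ᵇ≡true {m} {n} m<n with m <ᵇ n | <ᵇ-reflects-< m n
... | true  | _       = refl
... | false | ofⁿ m≮n = contradiction m<n m≮n

≥⇒<ᵇ≡false : ∀ {m n} → n ≤ m → (m <ᵇ n) ≡ false
≥⇒<ᵇ≡false {m} {n} n≤m with m <ᵇ n | <ᵇ-reflects-< m n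
... | true  | ofʸ m<n = contradiction m<n (≤⇒≯ n≤m)
... | false | _       = refl

<ᵇ≡true⇒< : ∀ {m n} → (m <ᵇ n) ≡ true → m < n
<ᵇ≡true⇒< {m} {n} m<ᵇn = <ᵇ⇒< m n (Equivalence.from T-≡ m<ᵇn)

<ᵇ-irrefl : ∀ n → (n <ᵇ n) ≡ false
<ᵇ-irrefl n = ≥⇒<ᵇ≡false (≤-refl {n})

pred[n]<n : ∀ {m} → 0 < m → pred m < m
pred[n]<n {suc m} _ = ≤-refl

SamePair : {A : Set} → A → A → A → A → Set
SamePair a b c d = (a ≡ c × b ≡ d) ⊎ (a ≡ d × b ≡ c)

SamePair-swap : {A : Set} {a b c d : A} → SamePair a b c d → SamePair a b d c
SamePair-swap (inj₁ (a≡c , b≡d)) = inj₂ (a≡c , b≡d)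
SamePair-swap (inj₂ (a≡d , b≡c)) = inj₁ (a≡d , b≡c)

inF-SamePair : ∀ {F : EdgeSet n} {a b c d} → SamePair a b c d → inF F a b ≡ inF F c d
inF-SamePair         (inj₁ (refl , refl)) = refl
inF-SamePair {F = F} (inj₂ (refl , refl)) = ∨-comm (F _ _) (F _ _)

inF-mono : ∀ {F F' : EdgeSet n} → (∀ i j → F i j ≡ true → F' i j ≡ true) →
           ∀ i j → inF F i j ≡ true → inF F' i j ≡ true
inF-mono {F = F} {F'} F⊆F' i j with F i j in Fij | F j i in Fji
... | true  | _     = λ _ → cong (_∨ F' j i) (F⊆F' i j Fij)
... | false | true  = λ _ → trans (cong (F' i j ∨_) (F⊆F' j i Fji)) (∨-zeroʳ _)
... | false | false = λ ()

sorted : Fin n → Fin n → Fin n × Fin n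
sorted a b = if toℕ a <ᵇ toℕ b then (a , b) else (b , a)

sorted-SamePair : (a b : Fin n) → SamePair (proj₁ (sorted a b)) (proj₂ (sorted a b)) a b
sorted-SamePair a b with toℕ a <ᵇ toℕ b
... | true  = inj₁ (refl , refl)
... | false = inj₂ (refl , refl)

inF-sorted : ∀ {F : EdgeSet n} a b → inF F (proj₁ (sorted a b)) (proj₂ (sorted a b)) ≡ inF F a b
inF-sorted {F = F} a b = inF-SamePair {F = F} (sorted-SamePair a b)

sorted-< : ∀ {a b : Fin n} → a ≢ b → toℕ (proj₁ (sorted a b)) < toℕ (proj₂ (sorted a b))
sorted-< {a = a} {b} a≢b with toℕ a <ᵇ toℕ b in a<ᵇb
... | true  = <ᵇ≡true⇒< a<ᵇb
... | false = ≤∧≢⇒< (≮⇒≥ λ a<b → true-false-≢ (<⇒<ᵇ≡true a<b) a<ᵇb refl)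
                   (λ b≡a → a≢b (toℕ-injective (sym b≡a)))

sorted-unique : ∀ {i j a b : Fin n} → toℕ i < toℕ j → SamePair i j a b → sorted a b ≡ (i , j)
sorted-unique i<j (inj₁ (refl , refl)) rewrite <⇒<ᵇ≡true i<j = refl
sorted-unique i<j (inj₂ (refl , refl)) rewrite ≥⇒<ᵇ≡false (<⇒≤ i<j) = refl

sorted-sym : ∀ {a b : Fin n} → a ≢ b → sorted a b ≡ sorted b a
sorted-sym {a = a} {b} a≢b =
  sym (sorted-unique (sorted-< a≢b) (SamePair-swap (sorted-SamePair a b)))

sorted-injective : ∀ {a b c d : Fin n} → sorted a b ≡ sorted c d → SamePair a b c d
sorted-injective {a = a} {b} {c} {d} eq with toℕ a <ᵇ toℕ b | toℕ c <ᵇ toℕ d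
... | true  | true  = inj₁ (cong proj₁ eq , cong proj₂ eq)
... | true  | false = inj₂ (cong proj₁ eq , cong proj₂ eq)
... | false | true  = inj₂ (cong proj₂ eq , cong proj₁ eq)
... | false | false = inj₁ (cong proj₂ eq , cong proj₁ eq)

key : Fin n × Fin n → ℕ
key (i , j) = toℕ (combine i j)

key-injective : ∀ {P Q : Fin n × Fin n} → key P ≡ key Q → P ≡ Q
key-injective {n} {i , j} {i' , j'} eq = begin
  (i , j)                    ≡⟨ remQuot-combine i j ⟨
  remQuot n (combine i j)    ≡⟨ cong (remQuot n) (toℕ-injective eq) ⟩
  remQuot n (combine i' j')  ≡⟨ remQuot-combine i' j' ⟩
  (i' , j')                  ∎
  where open ≡-Reasoning

preceding : Fin n × Fin n → EdgeSet n
preceding P i j = (toℕ i <ᵇ toℕ j) ∧ (key (i , j) <ᵇ key P)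

inF-preceding : ∀ {i j : Fin n} P → toℕ i < toℕ j → inF (preceding P) i j ≡ (key (i , j) <ᵇ key P)
inF-preceding P i<j rewrite <⇒<ᵇ≡true i<j | ≥⇒<ᵇ≡false (<⇒≤ i<j) = ∨-identityʳ _

preceding-mono : ∀ {P Q : Fin n × Fin n} → key P < key Q →
                 ∀ i j → preceding P i j ≡ true → preceding Q i j ≡ true
preceding-mono P<Q i j with toℕ i <ᵇ toℕ j
... | false = λ ()
... | true  = λ ij<P → <⇒<ᵇ≡true (<-trans (<ᵇ≡true⇒< ij<P) P<Q)

merge : ∀ {N} {i j : Fin N} → i ≢ j → Fin N → Fin (pred N)
merge {suc N} {i} {j} i≢j x with x ≟ j
... | yes _   = punchOut (≢-sym i≢j)
... | no x≢j = punchOut (≢-sym x≢j)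

merge-injective : ∀ {N} {i j : Fin N} (i≢j : i ≢ j) {x y} → merge i≢j x ≡ merge i≢j y →
                  x ≡ y ⊎ SamePair x y i j
merge-injective {suc N} {i} {j} i≢j {x} {y} eq with x ≟ j | y ≟ j
... | yes x≡j | yes y≡j = inj₁ (trans x≡j (sym y≡j))
... | yes x≡j | no y≢j  = inj₂ (inj₂ (x≡j , sym (punchOut-injective (≢-sym i≢j) (≢-sym y≢j) eq)))
... | no x≢j  | yes y≡j = inj₂ (inj₁ (punchOut-injective (≢-sym x≢j) (≢-sym i≢j) eq , y≡j))
... | no x≢j  | no y≢j  = inj₁ (punchOut-injective (≢-sym x≢j) (≢-sym y≢j) eq)

-- Vertex sets, their boundaries and stars

VertexSet : ℕ → Set
VertexSet n = Fin n → Bool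

δ : VertexSet n → EdgeSet n
δ X i j = X i xor X j

∁ : VertexSet n → VertexSet n
∁ X = not ∘ X

_∩_ _∪_ : VertexSet n → VertexSet n → VertexSet n
(X ∩ Y) x = X x ∧ Y x
(X ∪ Y) x = X x ∨ Y x

∁-disjoint : ∀ (X : VertexSet n) {x} → X x ≡ true → ∁ X x ≡ true → ⊥
∁-disjoint X Xx ∁Xx = true-false-≢ ∁Xx (cong not Xx) refl

differ : Bool → Bool → Bool
differ a b = (a xor b) ∨ (b xor a)

differ≡false⇒≡ : ∀ {a b} → differ a b ≡ false → a ≡ b
differ≡false⇒≡ {false} {false} _ = refl
differ≡false⇒≡ {true}  {true}  _ = refl

≡⇒differ≡false : ∀ {a b} → a ≡ b → differ a b ≡ false
≡⇒differ≡false {false} refl = refl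
≡⇒differ≡false {true}  refl = refl

≢⇒differ≡true : ∀ {a b} → a ≢ b → differ a b ≡ true
≢⇒differ≡true {false} {false} a≢b = contradiction refl a≢b
≢⇒differ≡true {false} {true}  _   = refl
≢⇒differ≡true {true}  {false} _   = refl
≢⇒differ≡true {true}  {true}  a≢b = contradiction refl a≢b

differ-not : ∀ a b → differ (not a) (not b) ≡ differ a b
differ-not false false = refl
differ-not false true  = refl
differ-not true  false = refl
differ-not true  true  = refl

differ-submodular : ∀ a a' b b' → 𝟙 (differ (a ∧ b) (a' ∧ b')) + 𝟙 (differ (a ∨ b) (a' ∨ b')) ≤
                                  𝟙 (differ a a') + 𝟙 (differ b b')
differ-submodular false false b     b'    = ≤-refl
differ-submodular true  true  b     b'    = ≤-reflexive (+-comm _ 0)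
differ-submodular true  false true  true  = ≤-refl
differ-submodular true  false true  false = ≤-refl
differ-submodular true  false false true  = z≤n
differ-submodular true  false false false = s≤s z≤n
differ-submodular false true  true  true  = ≤-refl
differ-submodular false true  true  false = z≤n
differ-submodular false true  false true  = ≤-refl
differ-submodular false true  false false = s≤s z≤n

star : Fin n → VertexSet n
star y x = does (x ≟ y)

star-self : (y : Fin n) → star y y ≡ true
star-self y = dec-true (y ≟ y) refl

star-other : ∀ {x y : Fin n} → x ≢ y → star y x ≡ false
star-other {x = x} {y} = dec-false (x ≟ y)

star-separates : ∀ {u v y : Fin n} → u ≢ v → y ≡ u ⊎ y ≡ v → star y u ≢ star y v
star-separates {u = u} u≢v (inj₁ refl) = true-false-≢ (star-self u) (star-other (≢-sym u≢v))
star-separates {v = v} u≢v (inj₂ refl) = ≢-sym (true-false-≢ (star-self v) (star-other u≢v))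

δ-star-∋ : ∀ {y x : Fin n} → y ≢ x → inF (δ (star y)) y x ≡ true
δ-star-∋ {y = y} y≢x = ≢⇒differ≡true (true-false-≢ (star-self y) (star-other (≢-sym y≢x)))

inF-δ-star : ∀ {i j y : Fin n} → inF (δ (star y)) i j ≡ true → (i ≡ y × j ≢ y) ⊎ (j ≡ y × i ≢ y)
inF-δ-star {i = i} {j} {y} with i ≟ y | j ≟ y
... | yes i≡y | no j≢y  = λ _ → inj₁ (i≡y , j≢y)
... | no i≢y  | yes j≡y = λ _ → inj₂ (j≡y , i≢y)
... | yes _   | yes _   = λ ()
... | no _    | no _    = λ ()

singleEdge : Fin n → Fin n → EdgeSet n
singleEdge a b i j = does (i ≟ a) ∧ does (j ≟ b)

singleEdge-∋ : (a b : Fin n) → inF (singleEdge a b) a b ≡ true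
singleEdge-∋ a b rewrite dec-true (a ≟ a) refl | dec-true (b ≟ b) refl = refl

inF-singleEdge : ∀ {a b i j : Fin n} → inF (singleEdge a b) i j ≡ true → SamePair i j a b
inF-singleEdge {a = a} {b} {i} {j} with i ≟ a | j ≟ b | j ≟ a | i ≟ b
... | yes i≡a | yes j≡b | _       | _       = λ _ → inj₁ (i≡a , j≡b)
... | _       | _       | yes j≡a | yes i≡b = λ _ → inj₂ (i≡b , j≡a)
... | no _    | _       | no _    | _       = λ ()
... | no _    | _       | yes _   | no _    = λ ()
... | yes _   | no _    | no _    | _       = λ ()
... | yes _   | no _    | yes _   | no _    = λ ()

module _ (G : Graph n) where

  adj⇒≢ : ∀ {a b} → adj G a b ≡ true → a ≢ b
  adj⇒≢ {a} ab refl = true-false-≢ ab (adj-irrefl G a) refl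

  adj-SamePair : ∀ {a b c d} → SamePair a b c d → adj G a b ≡ adj G c d
  adj-SamePair (inj₁ (refl , refl)) = refl
  adj-SamePair (inj₂ (refl , refl)) = adj-sym G _ _

  sorted-edge : ∀ {a b} → adj G a b ≡ true → adj G (proj₁ (sorted a b)) (proj₂ (sorted a b)) ≡ true
  sorted-edge {a} {b} ab = trans (adj-SamePair (sorted-SamePair a b)) ab

  weight : EdgeSet n → Fin n → Fin n → ℕ
  weight F i j = 𝟙 ((toℕ i <ᵇ toℕ j) ∧ adj G i j ∧ inF F i j)

  count≡∑₂ : ∀ F → count G F ≡ ∑₂ (weight F)
  count≡∑₂ F = trans (cong sum (map-tabulate id rowSum))
                     (cong sum (tabulate-cong λ i → cong sum (map-tabulate id (weight F i))))
    where
    rowSum : Fin n → ℕ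
    rowSum i = sum (map (weight F i) (allFin n))

  _⊆ᴱ_ : EdgeSet n → EdgeSet n → Set
  F ⊆ᴱ F' = ∀ i j → adj G i j ≡ true → inF F i j ≡ true → inF F' i j ≡ true

  weight-edge : ∀ {F i j} → toℕ i < toℕ j → adj G i j ≡ true → weight F i j ≡ 𝟙 (inF F i j)
  weight-edge i<j ij∈G rewrite <⇒<ᵇ≡true i<j | ij∈G = refl

  weight-mono : ∀ {F F'} → F ⊆ᴱ F' → ∀ i j → weight F i j ≤ weight F' i j
  weight-mono F⊆F' i j with toℕ i <ᵇ toℕ j | adj G i j | F⊆F' i j
  ... | false | _     | _       = z≤n
  ... | true  | false | _       = z≤n
  ... | true  | true  | ⊆-at-ij = 𝟙-mono (⊆-at-ij refl)

  count-mono : ∀ {F F'} → F ⊆ᴱ F' → count G F ≤ count G F'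
  count-mono {F} {F'} F⊆F' rewrite count≡∑₂ F | count≡∑₂ F' =
    ∑₂-mono-≤ {f = weight F} {weight F'} (weight-mono {F} {F'} F⊆F')

  count-mono-< : ∀ {F F' p q} → F ⊆ᴱ F' → toℕ p < toℕ q → adj G p q ≡ true →
                 inF F p q ≡ false → inF F' p q ≡ true → count G F < count G F'
  count-mono-< {F} {F'} {p} {q} F⊆F' p<q pq∈G pq∉F pq∈F' rewrite count≡∑₂ F | count≡∑₂ F' =
    ∑₂-mono-< {f = weight F} {weight F'} (weight-mono {F} {F'} F⊆F') p q strict
    where
    strict : weight F p q < weight F' p q
    strict rewrite weight-edge {F} p<q pq∈G | weight-edge {F'} p<q pq∈G | pq∉F | pq∈F' = ≤-refl

  count-∅ : count G ∅E ≡ 0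
  count-∅ = trans (count≡∑₂ ∅E) (∑₂-zero λ i j →
    cong 𝟙 (trans (cong ((toℕ i <ᵇ toℕ j) ∧_) (∧-zeroʳ (adj G i j))) (∧-zeroʳ _)))

  count-+-mono-≤ : ∀ {F₁ F₂ F₃ F₄} →
    (∀ i j → adj G i j ≡ true →
             𝟙 (inF F₁ i j) + 𝟙 (inF F₂ i j) ≤ 𝟙 (inF F₃ i j) + 𝟙 (inF F₄ i j)) →
    count G F₁ + count G F₂ ≤ count G F₃ + count G F₄
  count-+-mono-≤ {F₁} {F₂} {F₃} {F₄} on-edges
    rewrite count≡∑₂ F₁ | count≡∑₂ F₂ | count≡∑₂ F₃ | count≡∑₂ F₄ =
    subst₂ _≤_ (∑₂-distrib-+ (weight F₁) (weight F₂)) (∑₂-distrib-+ (weight F₃) (weight F₄))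
           (∑₂-mono-≤ weights)
    where
    weights : ∀ i j → weight F₁ i j + weight F₂ i j ≤ weight F₃ i j + weight F₄ i j
    weights i j with toℕ i <ᵇ toℕ j | adj G i j | on-edges i j
    ... | false | _     | _       = z≤n
    ... | true  | false | _       = z≤n
    ... | true  | true  | on-edge = on-edge refl

  count-≤1 : ∀ {F a b} → (∀ i j → adj G i j ≡ true → inF F i j ≡ true → SamePair i j a b) →
             count G F ≤ 1
  count-≤1 {F} {a} {b} F⊆ab = begin
    count G F      ≡⟨ count≡∑₂ F ⟩
    ∑₂ (weight F)  ≡⟨ ∑₂-single p q vanish ⟩
    weight F p q   ≤⟨ 𝟙≤1 _ ⟩
    1              ∎
    where
    open ≤-Reasoning
    p q : Fin n
    p = proj₁ (sorted a b)
    q = proj₂ (sorted a b)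
    vanish : ∀ i j → (i , j) ≢ sorted a b → weight F i j ≡ 0
    vanish i j ij≢ab with toℕ i <ᵇ toℕ j in i<j | adj G i j in ij∈G | inF F i j in ij∈F
    ... | false | _     | _     = refl
    ... | true  | false | _     = refl
    ... | true  | true  | false = refl
    ... | true  | true  | true  =
      contradiction (sym (sorted-unique (<ᵇ≡true⇒< i<j) (F⊆ab i j ij∈G ij∈F))) ij≢ab

  cutSize : VertexSet n → ℕ
  cutSize X = count G (δ X)

  cutSize-∁ : ∀ X → cutSize (∁ X) ≡ cutSize X
  cutSize-∁ X = ≤-antisym
    (count-mono {δ (∁ X)} {δ X} λ i j _ → trans (sym (differ-not (X i) (X j))))
    (count-mono {δ X} {δ (∁ X)} λ i j _ → trans (differ-not (X i) (X j)))

  cutSize-submodular : ∀ X Y → cutSize (X ∩ Y) + cutSize (X ∪ Y) ≤ cutSize X + cutSize Y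
  cutSize-submodular X Y = count-+-mono-≤ {δ (X ∩ Y)} {δ (X ∪ Y)} {δ X} {δ Y}
    λ i j _ → differ-submodular (X i) (X j) (Y i) (Y j)

  reach-δ-invariant : ∀ {X u x} → Reach G (δ X) u x → X x ≡ X u
  reach-δ-invariant here                = refl
  reach-δ-invariant (step walk _ wx∉δX) =
    trans (sym (differ≡false⇒≡ wx∉δX)) (reach-δ-invariant walk)

  δ-isCut : ∀ {X u v} → X u ≢ X v → IsCut G u v (δ X)
  δ-isCut Xu≢Xv walk = Xu≢Xv (sym (reach-δ-invariant walk))

  reach-prepend : ∀ {F w u x} → adj G w u ≡ true → inF F w u ≡ false →
                  Reach G F u x → Reach G F w x
  reach-prepend wu∈G wu∉F here                  = step here wu∈G wu∉F
  reach-prepend wu∈G wu∉F (step walk yx∈G yx∉F) = step (reach-prepend wu∈G wu∉F walk) yx∈G yx∉F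

  reach-sym : ∀ {F u x} → Reach G F u x → Reach G F x u
  reach-sym               here                     = here
  reach-sym {F} {x = x} (step {w} walk wx∈G wx∉F) =
    reach-prepend (trans (adj-sym G x w) wx∈G) (trans (∨-comm (F x w) (F w x)) wx∉F) (reach-sym walk)

  isCut-sym : ∀ {u v F} → IsCut G u v F → IsCut G v u F
  isCut-sym cut = cut ∘ reach-sym

  IsMinSide : Fin n → Fin n → VertexSet n → Set
  IsMinSide u v X = X u ≡ true × X v ≡ false × (∀ F → IsCut G u v F → cutSize X ≤ count G F)

  minSide-≤ : ∀ {u v X Y} → IsMinSide u v X → Y u ≢ Y v → cutSize X ≤ cutSize Y
  minSide-≤ {Y = Y} (_ , _ , minimal) Yu≢Yv = minimal (δ Y) (δ-isCut Yu≢Yv)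

  minSide-∁ : ∀ {u v X} → IsMinSide u v X → IsMinSide v u (∁ X)
  minSide-∁ {X = X} (Xu , Xv , minimal) = cong not Xv , cong not Xu ,
    λ F cut → subst (_≤ count G F) (sym (cutSize-∁ X)) (minimal F (isCut-sym cut))

  δ-isMinCut : ∀ {u v T Y} → IsMinSide u v T → Y u ≢ Y v → cutSize Y ≤ cutSize T →
               IsMinCut G u v (δ Y)
  δ-isMinCut (_ , _ , minimal) Yu≢Yv Y≤T = δ-isCut Yu≢Yv , λ F cut → ≤-trans Y≤T (minimal F cut)

  module _ {F : EdgeSet n} {u : Fin n} (reach? : ∀ x → Dec (Reach G F u x)) where

    reachable : VertexSet n
    reachable x = does (reach? x)

    reachable-closed : ∀ i j → adj G i j ≡ true → inF F i j ≡ false → reachable i ≡ reachable j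
    reachable-closed i j ij∈G ij∉F with reach? i | reach? j
    ... | yes _    | yes _    = refl
    ... | no _     | no _     = refl
    ... | yes walk | no ¬walk = contradiction (step walk ij∈G ij∉F) ¬walk
    ... | no ¬walk | yes walk =
      contradiction (step walk (trans (adj-sym G j i) ij∈G) (trans (∨-comm (F j i) (F i j)) ij∉F)) ¬walk

    δ-reachable⊆ᴱ : δ reachable ⊆ᴱ F
    δ-reachable⊆ᴱ i j ij∈G ij∈δ with inF F i j in ij∈F
    ... | true  = refl
    ... | false = contradiction (trans (sym ij∈δ) (≡⇒differ≡false (reachable-closed i j ij∈G ij∈F))) λ ()

    reachable-minSide : ∀ {v} → IsMinCut G u v F → IsMinSide u v reachable
    reachable-minSide {v} (cut , minimal) = reaches-u , misses-v ,
      λ F' cut' → ≤-trans (count-mono {δ reachable} {F} δ-reachable⊆ᴱ) (minimal F' cut')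
      where
      reaches-u : reachable u ≡ true
      reaches-u with reach? u
      ... | yes _    = refl
      ... | no ¬here = contradiction here ¬here
      misses-v : reachable v ≡ false
      misses-v with reach? v
      ... | yes walk = contradiction walk cut
      ... | no _     = refl

  HasMinCuts : Set
  HasMinCuts = ∀ u v → u ≢ v → Σ (EdgeSet n) (IsMinCut G u v)

  MinSides : Set
  MinSides = ∀ u v → u ≢ v → Σ (VertexSet n) (IsMinSide u v)

  ¬¬-minSides : HasMinCuts → ¬ ¬ MinSides
  ¬¬-minSides minCut = ¬¬-∀-Fin λ u → ¬¬-∀-Fin λ v → ¬¬-→ λ u≢v →
    ¬¬-map (λ reach? → reachable reach? , reachable-minSide reach? (proj₂ (minCut u v u≢v)))
           (¬¬-∀-Fin λ _ → ¬¬-excluded-middle)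

  -- Uncrossing

  ConstantOn : VertexSet n → VertexSet n → Set
  ConstantOn S X = ∀ {x y} → S x ≡ true → S y ≡ true → X x ≡ X y

  Avoids : VertexSet n → VertexSet n → Set
  Avoids S X = ConstantOn S X ⊎ ConstantOn (∁ S) X

  ∪-constantOn : ∀ Z W → ConstantOn W (Z ∪ W)
  ∪-constantOn Z W {x} {y} Wx Wy = trans (∪-true x Wx) (sym (∪-true y Wy))
    where
    ∪-true : ∀ z → W z ≡ true → (Z ∪ W) z ≡ true
    ∪-true z Wz = trans (cong (Z z ∨_) Wz) (∨-zeroʳ (Z z))

  -- Z ∩ W still separates p from q, so minimality of W turns submodularity into this bound.
  ∪-minSide-≤ : ∀ {p q W Z} → IsMinSide p q W → Z p ≡ true → cutSize (Z ∪ W) ≤ cutSize Z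
  ∪-minSide-≤ {p} {q} {W} {Z} W-min@(Wp , Wq , _) Zp = +-cancelˡ-≤ (cutSize W) _ _ (begin
    cutSize W + cutSize (Z ∪ W)        ≤⟨ +-monoˡ-≤ _ (minSide-≤ W-min separates) ⟩
    cutSize (Z ∩ W) + cutSize (Z ∪ W)  ≤⟨ cutSize-submodular Z W ⟩
    cutSize Z + cutSize W              ≡⟨ +-comm (cutSize Z) _ ⟩
    cutSize W + cutSize Z              ∎)
    where
    open ≤-Reasoning
    separates : (Z ∩ W) p ≢ (Z ∩ W) q
    separates rewrite Zp | Wp | Wq | ∧-zeroʳ (Z q) = λ ()

  Uncrossed : Fin n → Fin n → VertexSet n → VertexSet n → Set
  Uncrossed u v S T = Σ (VertexSet n) λ X → X u ≢ X v × cutSize X ≤ cutSize T × Avoids S X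

  uncross-∪ : ∀ {p q u v S W Z} → IsMinSide p q W → Z p ≡ true → Z u ≡ true → Z v ≡ false →
              W v ≡ false → (ConstantOn W (Z ∪ W) → Avoids S (Z ∪ W)) → Uncrossed u v S Z
  uncross-∪ {u = u} {W = W} {Z} W-min Zp Zu Zv Wv avoids =
    Z ∪ W , true-false-≢ (cong (_∨ W u) Zu) (cong₂ _∨_ Zv Wv) , ∪-minSide-≤ {Z = Z} W-min Zp ,
    avoids (∪-constantOn Z W)

  uncross-∁∪ : ∀ {p q u v S W Z} → IsMinSide p q W → Z p ≡ false → Z u ≡ true → Z v ≡ false →
               W u ≡ false → (ConstantOn W (∁ Z ∪ W) → Avoids S (∁ Z ∪ W)) → Uncrossed u v S Z
  uncross-∁∪ {Z = Z} W-min Zp Zu Zv Wu avoids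
    with X , Xv≢Xu , X≤∁Z , X-avoids ←
           uncross-∪ {Z = ∁ Z} W-min (cong not Zp) (cong not Zv) (cong not Zu) Wu avoids
    = X , ≢-sym Xv≢Xu , subst (_ ≤_) (cutSize-∁ Z) X≤∁Z , X-avoids

  uncross-itself : ∀ {p q u v S T} → IsMinSide p q S → S u ≢ S v → T p ≢ T q → Uncrossed u v S T
  uncross-itself {S = S} S-min Su≢Sv Tp≢Tq =
    S , Su≢Sv , minSide-≤ S-min Tp≢Tq , inj₁ λ Sx Sy → trans Sx (sym Sy)

  -- One of T ∪ W and ∁ T ∪ W with W ∈ {S, ∁ S} works, unless T separates p from q and
  -- S separates u from v, in which case S itself does.
  uncross : ∀ {p q u v S T} → IsMinSide p q S → T u ≡ true → T v ≡ false → Uncrossed u v S T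
  uncross {p} {q} {u} {v} {S} {T} S-min Tu Tv with T p in Tp | T q in Tq | S u in Su | S v in Sv
  ... | true  | true  | _     | false = uncross-∪  {Z = T} S-min Tp Tu Tv Sv inj₁
  ... | true  | true  | _     | true  = uncross-∪  {Z = T} (minSide-∁ S-min) Tq Tu Tv (cong not Sv) inj₂
  ... | false | false | false | _     = uncross-∁∪ {Z = T} S-min Tp Tu Tv Su inj₁
  ... | false | false | true  | _     = uncross-∁∪ {Z = T} (minSide-∁ S-min) Tq Tu Tv (cong not Su) inj₂
  ... | true  | false | _     | false = uncross-∪  {Z = T} S-min Tp Tu Tv Sv inj₁
  ... | true  | false | true  | true  = uncross-∁∪ {Z = T} (minSide-∁ S-min) Tq Tu Tv (cong not Su) inj₂
  ... | false | true  | false | _     = uncross-∁∪ {Z = T} S-min Tp Tu Tv Su inj₁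
  ... | false | true  | true  | true  = uncross-∪  {Z = T} (minSide-∁ S-min) Tq Tu Tv (cong not Sv) inj₂
  ... | true  | false | false | true  = uncross-itself S-min (≢-sym (true-false-≢ Sv Su)) (true-false-≢ Tp Tq)
  ... | false | true  | true  | false = uncross-itself S-min (true-false-≢ Su Sv) (≢-sym (true-false-≢ Tq Tp))

  -- Colourings with fewer than e(G) colours

  rank : Fin n → Fin n → ℕ
  rank a b = count G (preceding (sorted a b))

  count-preceding-< : ∀ {P Q} → toℕ (proj₁ P) < toℕ (proj₂ P) → adj G (proj₁ P) (proj₂ P) ≡ true →
                      key P < key Q → count G (preceding P) < count G (preceding Q)
  count-preceding-< {P} {Q} p<q pq∈G P<Q =
    count-mono-< {preceding P} {preceding Q} (λ i j _ → inF-mono (preceding-mono P<Q) i j) p<q pq∈G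
      (trans (inF-preceding P p<q) (<ᵇ-irrefl (key P))) (trans (inF-preceding Q p<q) (<⇒<ᵇ≡true P<Q))

  rank<e : ∀ {a b} → adj G a b ≡ true → rank a b < e G
  rank<e {a} {b} ab = count-mono-< {preceding (sorted a b)} {allE} (λ _ _ _ _ → refl)
    ordered (sorted-edge ab)
    (trans (inF-preceding (sorted a b) ordered) (<ᵇ-irrefl (key (sorted a b)))) refl
    where
    ordered : toℕ (proj₁ (sorted a b)) < toℕ (proj₂ (sorted a b))
    ordered = sorted-< (adj⇒≢ ab)

  rank-injective : ∀ {a b c d} → adj G a b ≡ true → adj G c d ≡ true → rank a b ≡ rank c d →
                   SamePair a b c d
  rank-injective {a} {b} {c} {d} ab cd eq with <-cmp (key (sorted a b)) (key (sorted c d))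
  ... | tri< P<Q _ _ =
    contradiction eq (<⇒≢ (count-preceding-< (sorted-< (adj⇒≢ ab)) (sorted-edge ab) P<Q))
  ... | tri≈ _ P≡Q _ = sorted-injective (key-injective P≡Q)
  ... | tri> _ _ Q<P =
    contradiction (sym eq) (<⇒≢ (count-preceding-< (sorted-< (adj⇒≢ cd)) (sorted-edge cd) Q<P))

  label : ∀ {a b} → adj G a b ≡ true → Fin (e G)
  label ab = fromℕ< (rank<e ab)

  label-injective : ∀ {a b c d} (ab : adj G a b ≡ true) (cd : adj G c d ≡ true) →
                    label ab ≡ label cd → SamePair a b c d
  label-injective ab cd eq = rank-injective ab cd
    (trans (sym (toℕ-fromℕ< (rank<e ab))) (trans (cong toℕ eq) (toℕ-fromℕ< (rank<e cd))))

  label-sym : ∀ {a b} (ab : adj G a b ≡ true) (ba : adj G b a ≡ true) → label ab ≡ label ba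
  label-sym {a} {b} ab ba = toℕ-injective (begin
    toℕ (label ab)  ≡⟨ toℕ-fromℕ< (rank<e ab) ⟩
    rank a b        ≡⟨ cong (count G ∘ preceding) (sorted-sym (adj⇒≢ ab)) ⟩
    rank b a        ≡⟨ toℕ-fromℕ< (rank<e ba) ⟨
    toℕ (label ba)  ∎)
    where open ≡-Reasoning

  SrdColouring : ℕ → Set
  SrdColouring k = Σ (EdgeColoring G k) (StrongRainbowDisconnected G)

  FewerColours : Set
  FewerColours = Σ ℕ λ k → k < e G × SrdColouring k

  fewerColours-merging : ∀ {c d c' d'} (cd : adj G c d ≡ true) (c'd' : adj G c' d' ≡ true) →
    ¬ SamePair c d c' d' →
    (∀ u v → u ≢ v → Σ (EdgeSet n) λ F → IsMinCut G u v F × (inF F c d ≡ false ⊎ inF F c' d' ≡ false)) →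
    FewerColours
  fewerColours-merging {c} {d} {c'} {d'} cd c'd' distinct cuts =
    pred (e G) , pred[n]<n (≤-<-trans z≤n (rank<e cd)) , (colour , colour-sym) , srd
    where
    labels-differ : label cd ≢ label c'd'
    labels-differ = distinct ∘ label-injective cd c'd'
    colour : (u v : Fin n) → adj G u v ≡ true → Fin (pred (e G))
    colour u v uv = merge labels-differ (label uv)
    colour-sym : ∀ u v (p : adj G u v ≡ true) (q : adj G v u ≡ true) → colour u v p ≡ colour v u q
    colour-sym u v p q = cong (merge labels-differ) (label-sym p q)
    srd : StrongRainbowDisconnected G (colour , colour-sym)
    srd u v u≢v with F , F-min , avoids ← cuts u v u≢v = F , F-min , rainbow
      where
      not-both : ∀ {a b a' b'} → SamePair a b c d → SamePair a' b' c' d' →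
                 inF F a b ≡ true → inF F a' b' ≡ true → ⊥
      not-both ab~cd a'b'~c'd' ab∈F a'b'∈F =
        [ (λ cd∉F → true-false-≢ (trans (sym (inF-SamePair {F = F} ab~cd)) ab∈F) cd∉F refl) ,
          (λ c'd'∉F → true-false-≢ (trans (sym (inF-SamePair {F = F} a'b'~c'd')) a'b'∈F) c'd'∉F refl)
        ]′ avoids
      rainbow : Rainbow G (colour , colour-sym) F
      rainbow a b a' b' ab a'b' ab∈F a'b'∈F same with merge-injective labels-differ same
      ... | inj₁ eq = label-injective ab a'b' eq
      ... | inj₂ (inj₁ (ab≈cd , a'b'≈c'd')) =
        ⊥-elim (not-both (label-injective ab cd ab≈cd) (label-injective a'b' c'd' a'b'≈c'd') ab∈F a'b'∈F)
      ... | inj₂ (inj₂ (ab≈c'd' , a'b'≈cd)) =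
        ⊥-elim (not-both (label-injective a'b' cd a'b'≈cd) (label-injective ab c'd' ab≈c'd') a'b'∈F ab∈F)

  InnerEdge : VertexSet n → Set
  InnerEdge X = ∃ λ i → ∃ λ j → adj G i j ≡ true × X i ≡ true × X j ≡ true

  innerEdge? : ∀ X → Dec (InnerEdge X)
  innerEdge? X = any? λ i → any? λ j → adj G i j ≟ᵇ true ×-dec X i ≟ᵇ true ×-dec X j ≟ᵇ true

  fewerColours-crossing : MinSides → ∀ {p q S} → IsMinSide p q S → InnerEdge S → InnerEdge (∁ S) →
                          FewerColours
  fewerColours-crossing sides {S = S} S-min (c , d , cd , Sc , Sd) (c' , d' , c'd' , ∁Sc' , ∁Sd') =
    fewerColours-merging cd c'd' distinct cuts
    where
    distinct : ¬ SamePair c d c' d'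
    distinct (inj₁ (refl , _)) = ∁-disjoint S Sc ∁Sc'
    distinct (inj₂ (refl , _)) = ∁-disjoint S Sc ∁Sd'
    cuts : ∀ u v → u ≢ v →
           Σ (EdgeSet n) λ F → IsMinCut G u v F × (inF F c d ≡ false ⊎ inF F c' d' ≡ false)
    cuts u v u≢v
      with T , T-min@(Tu , Tv , _) ← sides u v u≢v
      with X , Xu≢Xv , X≤T , avoids ← uncross S-min Tu Tv
      = δ X , δ-isMinCut {T = T} {Y = X} T-min Xu≢Xv X≤T ,
        [ (λ const → inj₁ (≡⇒differ≡false (const Sc Sd))) ,
          (λ const → inj₂ (≡⇒differ≡false (const ∁Sc' ∁Sd'))) ]′ avoids

  deg : Fin n → ℕ
  deg y = cutSize (star y)

  TwoNeighbours : Fin n → Set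
  TwoNeighbours w = ∃ λ a → ∃ λ b → a ≢ b × adj G w a ≡ true × adj G w b ≡ true

  deg-≥2 : ∀ {z} → TwoNeighbours z → 2 ≤ deg z
  deg-≥2 {z} (a , b , a≢b , za , zb) = ≤-<-trans ∅<za za<δz
    where
    ∅<za : 0 < count G (singleEdge z a)
    ∅<za = subst (_< count G (singleEdge z a)) count-∅
      (count-mono-< {∅E} {singleEdge z a} (λ _ _ _ ()) (sorted-< (adj⇒≢ za)) (sorted-edge za) refl
        (trans (inF-sorted {F = singleEdge z a} z a) (singleEdge-∋ z a)))
    zb∉za : inF (singleEdge z a) z b ≡ false
    zb∉za = ¬-not λ zb∈za → [ (λ (_ , b≡a) → a≢b (sym b≡a)) , (λ (z≡a , _) → adj⇒≢ za z≡a) ]′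
                             (inF-singleEdge {a = z} {a} {z} {b} zb∈za)
    za<δz : count G (singleEdge z a) < deg z
    za<δz = count-mono-< {singleEdge z a} {δ (star z)}
      (λ i j _ ij∈za → trans (inF-SamePair {F = δ (star z)} (inF-singleEdge {a = z} {a} {i} {j} ij∈za))
                             (δ-star-∋ (adj⇒≢ za)))
      (sorted-< (adj⇒≢ zb)) (sorted-edge zb)
      (trans (inF-sorted {F = singleEdge z a} z b) zb∉za)
      (trans (inF-sorted {F = δ (star z)} z b) (δ-star-∋ (adj⇒≢ zb)))

  deg-≤1 : ∀ {w c} → adj G w c ≡ true → ¬ TwoNeighbours w → deg w ≤ 1
  deg-≤1 {w} {c} wc ¬two = count-≤1 {δ (star w)} {w} {c} λ i j ij∈G ij∈δ →
    [ (λ { (refl , _) → inj₁ (refl , only-c ij∈G) }) ,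
      (λ { (refl , _) → inj₂ (only-c (trans (adj-sym G w i) ij∈G) , refl) })
    ]′ (inF-δ-star {i = i} {j} ij∈δ)
    where
    only-c : ∀ {x} → adj G w x ≡ true → x ≡ c
    only-c {x} wx = decidable-stable (x ≟ c) λ x≢c → ¬two (x , c , x≢c , wx , wc)

  deg-≤-cutSize : ∀ {X y} → ¬ InnerEdge X → X y ≡ true → deg y ≤ cutSize X
  deg-≤-cutSize {X} {y} no-inner Xy = count-mono {δ (star y)} {δ X} λ i j ij∈G ij∈δ →
    [ (λ { (refl , _) → ≢⇒differ≡true (true-false-≢ Xy (outside ij∈G)) }) ,
      (λ { (refl , _) → ≢⇒differ≡true (≢-sym (true-false-≢ Xy (outside (trans (adj-sym G y i) ij∈G)))) })
    ]′ (inF-δ-star {i = i} {j} ij∈δ)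
    where
    outside : ∀ {j} → adj G y j ≡ true → X j ≡ false
    outside {j} yj with X j in Xj
    ... | false = refl
    ... | true  = ⊥-elim (no-inner (y , j , yj , Xy , Xj))

  minStar : ∀ {u v T} → IsMinSide u v T → ¬ (InnerEdge T × InnerEdge (∁ T)) →
            Σ (Fin n) λ y → (y ≡ u ⊎ y ≡ v) × deg y ≤ cutSize T
  minStar {u} {v} {T} (Tu , Tv , _) not-both with innerEdge? T
  ... | no ¬inner = u , inj₁ refl , deg-≤-cutSize ¬inner Tu
  ... | yes inner = v , inj₂ refl ,
        subst (deg v ≤_) (cutSize-∁ T) (deg-≤-cutSize (not-both ∘ (inner ,_)) (cong not Tv))

  Crossing : MinSides → Set
  Crossing sides = ∃ λ p → ∃ λ q → Σ (p ≢ q) λ p≢q →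
    InnerEdge (proj₁ (sides p q p≢q)) × InnerEdge (∁ (proj₁ (sides p q p≢q)))

  fewerColours-star : (sides : MinSides) → ¬ Crossing sides → ∀ {w} → (∀ y → deg y ≤ deg w) →
                      TwoNeighbours w → FewerColours
  fewerColours-star sides no-crossing {w} w-max (a , b , a≢b , wa , wb) =
    fewerColours-merging wa wb distinct cuts
    where
    distinct : ¬ SamePair w a w b
    distinct (inj₁ (_ , a≡b))   = a≢b a≡b
    distinct (inj₂ (w≡b , a≡w)) = a≢b (trans a≡w w≡b)
    Avoiding : Fin n → Fin n → Set
    Avoiding u v = Σ (EdgeSet n) λ F → IsMinCut G u v F × (inF F w a ≡ false ⊎ inF F w b ≡ false)
    star-cut : ∀ {u v T y} → u ≢ v → IsMinSide u v T → y ≡ u ⊎ y ≡ v → y ≢ w →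
               deg y ≤ cutSize T → Avoiding u v
    star-cut {T = T} {y} u≢v T-min y∈uv y≢w y≤T =
      δ (star y) , δ-isMinCut {T = T} {Y = star y} T-min (star-separates u≢v y∈uv) y≤T , avoids
      where
      avoids : inF (δ (star y)) w a ≡ false ⊎ inF (δ (star y)) w b ≡ false
      avoids with a ≟ y
      ... | no _     = inj₁ (≡⇒differ≡false (star-other (≢-sym y≢w)))
      ... | yes refl =
        inj₂ (≡⇒differ≡false (trans (star-other (≢-sym y≢w)) (sym (star-other (≢-sym a≢b)))))
    cuts : ∀ u v → u ≢ v → Avoiding u v
    cuts u v u≢v = from-star (minStar {T = T} T-min not-both)
      where
      T : VertexSet n
      T = proj₁ (sides u v u≢v)
      T-min : IsMinSide u v T
      T-min = proj₂ (sides u v u≢v)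
      not-both : ¬ (InnerEdge T × InnerEdge (∁ T))
      not-both (inner , inner∁) = no-crossing (u , v , u≢v , inner , inner∁)
      from-star : Σ (Fin n) (λ y → (y ≡ u ⊎ y ≡ v) × deg y ≤ cutSize T) → Avoiding u v
      from-star (y , y∈uv , y≤T) with y ≟ w
      ... | no y≢w   = star-cut {T = T} u≢v T-min y∈uv y≢w y≤T
      -- The star at w contains both wa and wb, but by maximality of deg w the star at the
      -- other endpoint is no larger.
      ... | yes refl =
        [ (λ y≡u → star-cut {T = T} u≢v T-min (inj₂ refl) (λ v≡y → u≢v (trans (sym y≡u) (sym v≡y)))
                            (≤-trans (w-max v) y≤T)) ,
          (λ y≡v → star-cut {T = T} u≢v T-min (inj₁ refl) (λ u≡y → u≢v (trans u≡y y≡v))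
                            (≤-trans (w-max u) y≤T)) ]′ y∈uv

  reach-last-edge : ∀ {F v w} → Reach G F v w → v ≢ w → ∃ λ c → adj G w c ≡ true
  reach-last-edge here                      v≢v = contradiction refl v≢v
  reach-last-edge {w = w} (step {x} _ xw _) _   = x , trans (adj-sym G w x) xw

  has-neighbour : Connected G → ∀ {x y} → x ≢ y → ∀ w → ∃ λ c → adj G w c ≡ true
  has-neighbour conn {x} {y} x≢y w with x ≟ w
  ... | yes refl = reach-last-edge (conn y x) (≢-sym x≢y)
  ... | no x≢w   = reach-last-edge (conn x w) x≢w

  reach-matching : (∀ {w a b} → adj G w a ≡ true → adj G w b ≡ true → a ≡ b) →
                   ∀ {F x y} → Reach G F x y → y ≡ x ⊎ adj G x y ≡ true
  reach-matching unique here = inj₁ refl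
  reach-matching unique (step {w} walk wy _) with reach-matching unique walk
  ... | inj₁ refl = inj₂ wy
  ... | inj₂ xw   = inj₁ (unique wy (trans (adj-sym G w _) xw))

  ¬¬-twoNeighbours : Connected G → ∀ {x y z} → x ≢ y → x ≢ z → y ≢ z → ¬ ¬ ∃ TwoNeighbours
  ¬¬-twoNeighbours conn {x} x≢y x≢z y≢z ¬two = y≢z (unique (adjacent x≢y) (adjacent x≢z))
    where
    unique : ∀ {w a b} → adj G w a ≡ true → adj G w b ≡ true → a ≡ b
    unique {w} {a} {b} wa wb = decidable-stable (a ≟ b) λ a≢b → ¬two (w , a , b , a≢b , wa , wb)
    adjacent : ∀ {v} → x ≢ v → adj G x v ≡ true
    adjacent {v} x≢v = [ (λ v≡x → contradiction (sym v≡x) x≢v) , id ]′ (reach-matching unique (conn x v))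

  ¬¬-twoNeighbours-max : ∀ {w c z} → adj G w c ≡ true → deg z ≤ deg w → TwoNeighbours z →
                         ¬ ¬ TwoNeighbours w
  ¬¬-twoNeighbours-max wc z≤w z-two ¬two = <⇒≱ (≤-trans (deg-≥2 z-two) z≤w) (deg-≤1 wc ¬two)

  ¬¬-fewerColours : Connected G → HasMinCuts → ∀ {x y z} → x ≢ y → x ≢ z → y ≢ z →
                    ¬ ¬ FewerColours
  ¬¬-fewerColours conn minCuts {x} x≢y x≢z y≢z = do
    sides ← ¬¬-minSides minCuts
    yes (p , q , p≢q , inner , inner∁) ← ¬¬-excluded-middle {A = Crossing sides}
      where no no-crossing → do
        (z , z-two) ← ¬¬-twoNeighbours conn x≢y x≢z y≢z
        let (w , w-max) = ∃-argmax deg x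
        w-two ← ¬¬-twoNeighbours-max (proj₂ (has-neighbour conn x≢y w)) (w-max z) z-two
        pure (fewerColours-star sides no-crossing w-max w-two)
    pure (fewerColours-crossing sides (proj₂ (sides p q p≢q)) inner inner∁)
    where open RawMonad ¬¬-Monad

-- Graphs on two vertices

module _ (G : Graph 2) where

  connected⇒edge₂ : Connected G → adj G zero (suc zero) ≡ true
  connected⇒edge₂ conn with reach-last-edge G (conn (suc zero) zero) (λ ())
  ... | zero     , 00∈G = contradiction (trans (sym 00∈G) (adj-irrefl G zero)) λ ()
  ... | suc zero , 01∈G = 01∈G

  module _ (01∈G : adj G zero (suc zero) ≡ true) where

    pair₂ : ∀ {u v : Fin 2} → u ≢ v → SamePair u v zero (suc zero)
    pair₂ {zero}     {zero}     0≢0 = contradiction refl 0≢0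
    pair₂ {zero}     {suc zero} _   = inj₁ (refl , refl)
    pair₂ {suc zero} {zero}     _   = inj₂ (refl , refl)
    pair₂ {suc zero} {suc zero} 1≢1 = contradiction refl 1≢1

    ≅P₂ : Iso G P₂
    ≅P₂ = ↔-id (Fin 2) , same-adj
      where
      same-adj : ∀ u v → adj G u v ≡ adj P₂ u v
      same-adj zero       zero       = adj-irrefl G zero
      same-adj zero       (suc zero) = 01∈G
      same-adj (suc zero) zero       = trans (adj-sym G (suc zero) zero) 01∈G
      same-adj (suc zero) (suc zero) = adj-irrefl G (suc zero)

    single-colour : SrdColouring G 1
    single-colour = (colour , λ _ _ _ _ → refl) , λ u v u≢v → allE , (cut u≢v , minimal u≢v) , rainbow
      where
      colour : (u v : Fin 2) → adj G u v ≡ true → Fin 1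
      colour _ _ _ = zero
      cut : ∀ {u v} → u ≢ v → IsCut G u v allE
      cut u≢u here          = u≢u refl
      cut _   (step _ _ ())
      minimal : ∀ {u v} → u ≢ v → ∀ F → IsCut G u v F → count G allE ≤ count G F
      minimal u≢v F F-cut = count-mono G {allE} {F} λ i j ij∈G _ →
        trans (inF-SamePair {F = F} (pair₂ (adj⇒≢ G ij∈G))) 01∈F
        where
        01∈F : inF F zero (suc zero) ≡ true
        01∈F = ¬-not λ 01∉F → F-cut (step here (trans (adj-SamePair G (pair₂ u≢v)) 01∈G)
                                                (trans (inF-SamePair {F = F} (pair₂ u≢v)) 01∉F))
      rainbow : Rainbow G (colour , λ _ _ _ _ → refl) allE
      rainbow a b a' b' ab a'b' _ _ _ with pair₂ (adj⇒≢ G ab) | pair₂ (adj⇒≢ G a'b')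
      ... | inj₁ (refl , refl) | inj₁ (refl , refl) = inj₁ (refl , refl)
      ... | inj₁ (refl , refl) | inj₂ (refl , refl) = inj₂ (refl , refl)
      ... | inj₂ (refl , refl) | inj₁ (refl , refl) = inj₂ (refl , refl)
      ... | inj₂ (refl , refl) | inj₂ (refl , refl) = inj₁ (refl , refl)

    srd≡e₂ : ∀ {k} → IsSrd G k → k ≡ e G
    srd≡e₂ {k} (((colour , _) , _) , minimal) = begin
      k    ≡⟨ ≤-antisym (minimal 1 single-colour) (colour-exists (colour zero (suc zero) 01∈G)) ⟩
      1    ≡⟨ e≡1 ⟨
      e G  ∎
      where
      open ≡-Reasoning
      colour-exists : Fin k → 1 ≤ k
      colour-exists zero    = s≤s z≤n
      colour-exists (suc _) = s≤s z≤n
      e≡1 : e G ≡ 1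
      e≡1 rewrite 01∈G = refl

corollary2p5 : ∀ {n} (G : Graph n) → 2 ≤ n → Connected G →
    ∀ k → IsSrd G k → (k ≡ e G) ⇔ Iso G P₂
corollary2p5 {1} G (s≤s ()) _ _ _
corollary2p5 {2} G _ conn k k-srd = mk⇔ (λ _ → ≅P₂ G 01∈G) (λ _ → srd≡e₂ G 01∈G k-srd)
  where
  01∈G : adj G zero (suc zero) ≡ true
  01∈G = connected⇒edge₂ G conn
corollary2p5 {suc (suc (suc _))} G _ conn k ((_ , srd) , minimal) = mk⇔
  (λ k≡e → ⊥-elim (¬¬-fewerColours G conn minCuts {zero} {suc zero} {suc (suc zero)} (λ ()) (λ ()) (λ ())
                     λ (k' , k'<e , colouring) → <⇒≢ (≤-<-trans (minimal k' colouring) k'<e) k≡e))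
  (λ iso → contradiction (↔⇒≡ (proj₁ iso)) λ ())
  where
  minCuts : HasMinCuts G
  minCuts u v u≢v = proj₁ (srd u v u≢v) , proj₁ (proj₂ (srd u v u≢v))
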